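{- For positive integers $b$ and $j$ let \[ B_j(b)= b^2\binom{(j+2)b-2}{b-1}\left(\tfrac12\right)^{(j+2)b-1}. \] Then $B_1(b)\le 1.4$ for all $b\in\mathbb{N}$, $b\ge1$.
   Context: In the paper, $B_j(b)$ is the upper bound on $E[H_j]$, the expected number of "holes" in the $j$-th region (of $b$ slots) of a shared buffer of size $2k$, under a uniform stochastic scheduler. -}

module Defs where

open import Data.Nat as ℕ using (ℕ; zero; suc; _∸_)
open import Data.Nat.Combinatorics using (_C_)
open import Data.Rational using (ℚ; _*_; 1ℚ; ½; _/_)
open import Data.Integer using (+_)

half^ : ℕ → ℚ
half^ zero    = 1ℚ
half^ (suc n) = ½ * half^ n

ℕtoℚ : ℕ → ℚ
ℕtoℚ n = (+ n) / 1

B : ℕ → ℕ → ℚ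
B j b = ℕtoℚ (b ℕ.* b ℕ.* ((((j ℕ.+ 2) ℕ.* b) ∸ 2) C (b ∸ 1)))
        * half^ (((j ℕ.+ 2) ℕ.* b) ∸ 1)

module Submission where

-- Writing b = c + 1, B₁(b) = (c+1)² C(3c+1, c) / 2^(3c+2), so it suffices to show
-- 5 (c+1)² C(3c+1, c) ≤ 7 · 2^(3c+2).  The absorption identity k C(n,k) = n C(n-1,k-1) and
-- its mirror image give the exact ratio of consecutive central terms
--   C(3c+4, c+1) / C(3c+1, c) = (3c+2)(3c+3)(3c+4) / ((c+1)(2c+2)(2c+3)),
-- so the numerator grows by a factor below 8 = 2³ once c ≥ 8, while the denominator grows by
-- exactly 8.  The cases c ≤ 8 are checked by computation (the worst is c = 8, about 1.31).

open import Defs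

module Binomial where

  open import Data.Nat
  open import Data.Nat.Properties
  open import Data.Nat.Combinatorics using (_C_; nC1≡n; k>n⇒nCk≡0; nCk≡nC[n∸k]; nCk+nC[k+1]≡[n+1]C[k+1])
  open import Data.Nat.Tactic.RingSolver using (solve-∀)
  open import Relation.Binary.PropositionalEquality

  [k+1]*[n+1]C[k+1]≡[n+1]*nCk : ∀ n k → suc k * (suc n C suc k) ≡ suc n * (n C k)
  [k+1]*[n+1]C[k+1]≡[n+1]*nCk zero    zero    = refl
  [k+1]*[n+1]C[k+1]≡[n+1]*nCk zero    (suc k) =
    trans (cong (suc (suc k) *_) (k>n⇒nCk≡0 {1} {suc (suc k)} (s≤s (s≤s z≤n)))) (*-zeroʳ (suc (suc k)))
  [k+1]*[n+1]C[k+1]≡[n+1]*nCk (suc n) zero    = begin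
    1 * (suc (suc n) C 1)  ≡⟨ *-identityˡ _ ⟩
    suc (suc n) C 1        ≡⟨ nC1≡n (suc (suc n)) ⟩
    suc (suc n)            ≡⟨ *-identityʳ (suc (suc n)) ⟨
    suc (suc n) * 1        ∎
    where open ≡-Reasoning
  [k+1]*[n+1]C[k+1]≡[n+1]*nCk (suc n) (suc k) = begin
    suc (suc k) * (suc (suc n) C suc (suc k))
      ≡⟨ cong (suc (suc k) *_) (nCk+nC[k+1]≡[n+1]C[k+1] (suc n) (suc k)) ⟨
    suc (suc k) * (suc n C suc k + suc n C suc (suc k))
      ≡⟨ split (suc k) (suc n C suc k) (suc n C suc (suc k)) ⟩
    suc n C suc k + suc k * (suc n C suc k) + suc (suc k) * (suc n C suc (suc k))
      ≡⟨ cong₂ (λ u v → suc n C suc k + u + v) ([k+1]*[n+1]C[k+1]≡[n+1]*nCk n k)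
                                                  ([k+1]*[n+1]C[k+1]≡[n+1]*nCk n (suc k)) ⟩
    suc n C suc k + suc n * (n C k) + suc n * (n C suc k)
      ≡⟨ merge (suc n) (suc n C suc k) (n C k) (n C suc k) ⟩
    suc n C suc k + suc n * (n C k + n C suc k)
      ≡⟨ cong (λ u → suc n C suc k + suc n * u) (nCk+nC[k+1]≡[n+1]C[k+1] n k) ⟩
    suc (suc n) * (suc n C suc k)
      ∎
    where
    open ≡-Reasoning
    split : ∀ k x y → suc k * (x + y) ≡ x + k * x + suc k * y
    split = solve-∀
    merge : ∀ m x y z → x + m * y + m * z ≡ x + m * (y + z)
    merge = solve-∀

  [m+n]Cm≡[m+n]Cn : ∀ m n → (m + n) C m ≡ (m + n) C n
  [m+n]Cm≡[m+n]Cn m n = trans (nCk≡nC[n∸k] (m≤m+n m n)) (cong ((m + n) C_) (m+n∸m≡n m n))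

  [m+1]*[m+k+1]Ck≡[m+k+1]*[m+k]Ck : ∀ m k → suc m * (suc (m + k) C k) ≡ suc (m + k) * ((m + k) C k)
  [m+1]*[m+k+1]Ck≡[m+k+1]*[m+k]Ck m k = begin
    suc m * (suc (m + k) C k)      ≡⟨ cong (suc m *_) ([m+n]Cm≡[m+n]Cn (suc m) k) ⟨
    suc m * (suc (m + k) C suc m)  ≡⟨ [k+1]*[n+1]C[k+1]≡[n+1]*nCk (m + k) m ⟩
    suc (m + k) * ((m + k) C m)    ≡⟨ cong (suc (m + k) *_) ([m+n]Cm≡[m+n]Cn m k) ⟩
    suc (m + k) * ((m + k) C k)    ∎
    where open ≡-Reasoning

module NumeratorBound where

  open import Data.Nat
  open import Data.Nat.Properties
  open import Data.Nat.Combinatorics using (_C_)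
  open import Data.Nat.Tactic.RingSolver using (solve-∀)
  open import Data.Unit using (tt)
  open import Relation.Binary.PropositionalEquality
  open import Algebra.Properties.CommutativeSemigroup *-commutativeSemigroup using (x∙yz≈y∙xz)
  open Binomial

  [1+3c]Cc : ℕ → ℕ
  [1+3c]Cc c = (1 + 3 * c) C c

  [1+3c]Cc-ratio : ∀ c → suc c * (2 + 2 * c) * (3 + 2 * c) * [1+3c]Cc (suc c)
                       ≡ (2 + 3 * c) * (3 + 3 * c) * (4 + 3 * c) * [1+3c]Cc c
  [1+3c]Cc-ratio c = begin
    suc c * (2 + 2 * c) * (3 + 2 * c) * [1+3c]Cc (suc c)
      ≡⟨ regroup₁ (suc c) (2 + 2 * c) (3 + 2 * c) ([1+3c]Cc (suc c)) ⟩
    (2 + 2 * c) * ((3 + 2 * c) * (suc c * [1+3c]Cc (suc c)))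
      ≡⟨ cong (λ x → (2 + 2 * c) * ((3 + 2 * c) * x)) step₁ ⟩
    (2 + 2 * c) * ((3 + 2 * c) * ((4 + 3 * c) * ((3 + 3 * c) C c)))
      ≡⟨ regroup₂ (2 + 2 * c) (3 + 2 * c) (4 + 3 * c) ((3 + 3 * c) C c) ⟩
    (4 + 3 * c) * ((2 + 2 * c) * ((3 + 2 * c) * ((3 + 3 * c) C c)))
      ≡⟨ cong (λ x → (4 + 3 * c) * ((2 + 2 * c) * x)) step₂ ⟩
    (4 + 3 * c) * ((2 + 2 * c) * ((3 + 3 * c) * ((2 + 3 * c) C c)))
      ≡⟨ cong ((4 + 3 * c) *_) (x∙yz≈y∙xz (2 + 2 * c) (3 + 3 * c) ((2 + 3 * c) C c)) ⟩
    (4 + 3 * c) * ((3 + 3 * c) * ((2 + 2 * c) * ((2 + 3 * c) C c)))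
      ≡⟨ cong (λ x → (4 + 3 * c) * ((3 + 3 * c) * x)) step₃ ⟩
    (4 + 3 * c) * ((3 + 3 * c) * ((2 + 3 * c) * [1+3c]Cc c))
      ≡⟨ regroup₃ (4 + 3 * c) (3 + 3 * c) (2 + 3 * c) ([1+3c]Cc c) ⟩
    (2 + 3 * c) * (3 + 3 * c) * (4 + 3 * c) * [1+3c]Cc c
      ∎
    where
    open ≡-Reasoning
    1+3[1+c]≡4+3c : ∀ c → 1 + 3 * suc c ≡ 4 + 3 * c
    1+3[1+c]≡4+3c = solve-∀
    k+2c+c≡k+3c : ∀ k c → k + 2 * c + c ≡ k + 3 * c
    k+2c+c≡k+3c = solve-∀
    regroup₁ : ∀ a b c x → a * b * c * x ≡ b * (c * (a * x))
    regroup₁ = solve-∀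
    regroup₂ : ∀ a b c x → a * (b * (c * x)) ≡ c * (a * (b * x))
    regroup₂ = solve-∀
    regroup₃ : ∀ a b c x → a * (b * (c * x)) ≡ c * b * a * x
    regroup₃ = solve-∀
    step₁ : suc c * [1+3c]Cc (suc c) ≡ (4 + 3 * c) * ((3 + 3 * c) C c)
    step₁ = subst (λ n → suc c * (n C suc c) ≡ (4 + 3 * c) * ((3 + 3 * c) C c))
                  (sym (1+3[1+c]≡4+3c c)) ([k+1]*[n+1]C[k+1]≡[n+1]*nCk (3 + 3 * c) c)
    step₂ : (3 + 2 * c) * ((3 + 3 * c) C c) ≡ (3 + 3 * c) * ((2 + 3 * c) C c)
    step₂ = subst (λ n → (3 + 2 * c) * (suc n C c) ≡ suc n * (n C c))
                  (k+2c+c≡k+3c 2 c) ([m+1]*[m+k+1]Ck≡[m+k+1]*[m+k]Ck (2 + 2 * c) c)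
    step₃ : (2 + 2 * c) * ((2 + 3 * c) C c) ≡ (2 + 3 * c) * [1+3c]Cc c
    step₃ = subst (λ n → (2 + 2 * c) * (suc n C c) ≡ suc n * (n C c))
                  (k+2c+c≡k+3c 1 c) ([m+1]*[m+k+1]Ck≡[m+k+1]*[m+k]Ck (1 + 2 * c) c)

  ratio-poly : ∀ d → let c = 8 + d in
    (2 + c) * (2 + c) * ((2 + 3 * c) * (3 + 3 * c) * (4 + 3 * c))
      ≤ 8 * (suc c * suc c) * (suc c * (2 + 2 * c) * (3 + 2 * c))
  ratio-poly d = ≤-trans (m≤m+n _ _) (≤-reflexive (sym (expand d)))
    where
    -- The difference, expanded at c = 8 + d, has only nonnegative coefficients.  The large
    -- constants stand to the right of _+_ and _*_: on the left they would unfold into unary numerals.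
    expand : ∀ d → let c = 8 + d in
      8 * (suc c * suc c) * (suc c * (2 + 2 * c) * (3 + 2 * c))
        ≡ (2 + c) * (2 + c) * ((2 + 3 * c) * (3 + 3 * c) * (4 + 3 * c))
          + (d * d * d * d * d * 5 + d * d * d * d * 187 + d * d * d * 2658 + d * d * 17340 + d * 47496 + 28944)
    expand = solve-∀

  B₁-num : ℕ → ℕ
  B₁-num c = suc c * suc c * [1+3c]Cc c

  B₁-num-ratio : ∀ d → B₁-num (9 + d) ≤ 8 * B₁-num (8 + d)
  B₁-num-ratio d = *-cancelʳ-≤ (B₁-num (suc c)) (8 * B₁-num c) K (begin
    B₁-num (suc c) * K                          ≡⟨ regroup₁ (2 + c) ([1+3c]Cc (suc c)) K ⟩
    (2 + c) * (2 + c) * (K * [1+3c]Cc (suc c))  ≡⟨ cong ((2 + c) * (2 + c) *_) ([1+3c]Cc-ratio c) ⟩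
    (2 + c) * (2 + c) * (L * [1+3c]Cc c)        ≡⟨ *-assoc ((2 + c) * (2 + c)) L ([1+3c]Cc c) ⟨
    (2 + c) * (2 + c) * L * [1+3c]Cc c          ≤⟨ *-monoˡ-≤ ([1+3c]Cc c) (ratio-poly d) ⟩
    8 * (suc c * suc c) * K * [1+3c]Cc c        ≡⟨ regroup₂ (suc c) K ([1+3c]Cc c) ⟩
    8 * B₁-num c * K                            ∎)
    where
    open ≤-Reasoning
    c = 8 + d
    K = suc c * (2 + 2 * c) * (3 + 2 * c)
    L = (2 + 3 * c) * (3 + 3 * c) * (4 + 3 * c)
    regroup₁ : ∀ s t k → s * s * t * k ≡ s * s * (k * t)
    regroup₁ = solve-∀
    regroup₂ : ∀ s k t → 8 * (s * s) * k * t ≡ 8 * (s * s * t) * k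
    regroup₂ = solve-∀

  B₁-num-bound-step : ∀ c → B₁-num (suc c) ≤ 8 * B₁-num c →
                      5 * B₁-num c ≤ 7 * 2 ^ (2 + 3 * c) → 5 * B₁-num (suc c) ≤ 7 * 2 ^ (2 + 3 * suc c)
  B₁-num-bound-step c ratio bound = begin
    5 * B₁-num (suc c)         ≤⟨ *-monoʳ-≤ 5 ratio ⟩
    5 * (8 * B₁-num c)         ≡⟨ x∙yz≈y∙xz 5 8 (B₁-num c) ⟩
    8 * (5 * B₁-num c)         ≤⟨ *-monoʳ-≤ 8 bound ⟩
    8 * (7 * 2 ^ (2 + 3 * c))  ≡⟨ x∙yz≈y∙xz 8 7 (2 ^ (2 + 3 * c)) ⟩
    7 * (8 * 2 ^ (2 + 3 * c))  ≡⟨ cong (7 *_) (^-distribˡ-+-* 2 3 (2 + 3 * c)) ⟨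
    7 * 2 ^ (3 + (2 + 3 * c))  ≡⟨ cong (λ e → 7 * 2 ^ e) (exponent c) ⟩
    7 * 2 ^ (2 + 3 * suc c)    ∎
    where
    open ≤-Reasoning
    exponent : ∀ c → 3 + (2 + 3 * c) ≡ 2 + 3 * suc c
    exponent = solve-∀

  B₁-num-bound : ∀ c → 5 * B₁-num c ≤ 7 * 2 ^ (2 + 3 * c)
  B₁-num-bound 0 = ≤ᵇ⇒≤ _ _ tt
  B₁-num-bound 1 = ≤ᵇ⇒≤ _ _ tt
  B₁-num-bound 2 = ≤ᵇ⇒≤ _ _ tt
  B₁-num-bound 3 = ≤ᵇ⇒≤ _ _ tt
  B₁-num-bound 4 = ≤ᵇ⇒≤ _ _ tt
  B₁-num-bound 5 = ≤ᵇ⇒≤ _ _ tt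
  B₁-num-bound 6 = ≤ᵇ⇒≤ _ _ tt
  B₁-num-bound 7 = ≤ᵇ⇒≤ _ _ tt
  B₁-num-bound 8 = ≤ᵇ⇒≤ _ _ tt
  B₁-num-bound (suc c@(suc (suc (suc (suc (suc (suc (suc (suc d))))))))) =
    B₁-num-bound-step c (B₁-num-ratio d) (B₁-num-bound c)

module DyadicBound where

  open import Data.Nat as ℕ using (ℕ; zero; suc)
  import Data.Nat.Properties as ℕP
  open import Data.Nat.Combinatorics using (_C_)
  open import Data.Nat.Tactic.RingSolver using (solve-∀)
  open import Data.Integer as ℤ using (+_)
  import Data.Integer.Properties as ℤP
  open import Data.Rational as ℚ using (toℚᵘ; ½)
  import Data.Rational.Properties as ℚP
  open import Data.Rational.Unnormalised as ℚᵘ using (mkℚᵘ; *≡*; *≤*)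
  import Data.Rational.Unnormalised.Properties as ℚᵘP
  open import Relation.Binary.PropositionalEquality
  open NumeratorBound using (B₁-num)

  -- 2^e − 1 by a recursion that keeps mkℚᵘ (+ 1) (pred2^ e) = 1/2^e free of subtraction.
  pred2^ : ℕ → ℕ
  pred2^ zero    = 0
  pred2^ (suc e) = suc (2 ℕ.* pred2^ e)

  2*[1+n]≡2+2n : ∀ n → 2 ℕ.* suc n ≡ suc (suc (2 ℕ.* n))
  2*[1+n]≡2+2n = solve-∀

  suc-pred2^ : ∀ e → suc (pred2^ e) ≡ 2 ℕ.^ e
  suc-pred2^ zero    = refl
  suc-pred2^ (suc e) = trans (sym (2*[1+n]≡2+2n (pred2^ e))) (cong (2 ℕ.*_) (suc-pred2^ e))

  toℚᵘ-half^ : ∀ e → toℚᵘ (half^ e) ℚᵘ.≃ mkℚᵘ (+ 1) (pred2^ e)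
  toℚᵘ-half^ zero    = ℚᵘP.≃-refl
  toℚᵘ-half^ (suc e) = begin
    toℚᵘ (½ ℚ.* half^ e)               ≈⟨ ℚP.toℚᵘ-homo-* ½ (half^ e) ⟩
    toℚᵘ ½ ℚᵘ.* toℚᵘ (half^ e)         ≈⟨ ℚᵘP.*-congˡ {toℚᵘ ½} (toℚᵘ-half^ e) ⟩
    toℚᵘ ½ ℚᵘ.* mkℚᵘ (+ 1) (pred2^ e)  ≈⟨ *≡* (cong (λ m → + 1 ℤ.* + m) (sym (2*[1+n]≡2+2n (pred2^ e)))) ⟩
    mkℚᵘ (+ 1) (pred2^ (suc e))        ∎
    where open ℚᵘP.≃-Reasoning

  ℕtoℚ*half^≤ : ∀ n e p d → suc d ℕ.* n ℕ.≤ p ℕ.* 2 ℕ.^ e → ℕtoℚ n ℚ.* half^ e ℚ.≤ + p ℚ./ suc d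
  ℕtoℚ*half^≤ n e p d sd*n≤p*2^e = ℚP.toℚᵘ-cancel-≤ (begin
    toℚᵘ (ℕtoℚ n ℚ.* half^ e)                ≃⟨ ℚP.toℚᵘ-homo-* (ℕtoℚ n) (half^ e) ⟩
    toℚᵘ (ℕtoℚ n) ℚᵘ.* toℚᵘ (half^ e)        ≃⟨ ℚᵘP.*-cong (ℚP.toℚᵘ-fromℚᵘ (mkℚᵘ (+ n) 0)) (toℚᵘ-half^ e) ⟩
    mkℚᵘ (+ n) 0 ℚᵘ.* mkℚᵘ (+ 1) (pred2^ e)  ≤⟨ *≤* (subst₂ ℤ._≤_ lhs rhs (ℤ.+≤+ n*1*sd≤p*[1*2^e])) ⟩
    mkℚᵘ (+ p) d                             ≃⟨ ℚP.toℚᵘ-fromℚᵘ (mkℚᵘ (+ p) d) ⟨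
    toℚᵘ (+ p ℚ./ suc d)                     ∎)
    where
    open ℚᵘP.≤-Reasoning
    reorder : ∀ n d → suc d ℕ.* n ≡ n ℕ.* 1 ℕ.* suc d
    reorder = solve-∀
    n*1*sd≤p*[1*2^e] : n ℕ.* 1 ℕ.* suc d ℕ.≤ p ℕ.* (1 ℕ.* suc (pred2^ e))
    n*1*sd≤p*[1*2^e] = subst₂ ℕ._≤_ (reorder n d)
      (cong (p ℕ.*_) (sym (trans (ℕP.*-identityˡ _) (suc-pred2^ e)))) sd*n≤p*2^e
    lhs : + (n ℕ.* 1 ℕ.* suc d) ≡ + n ℤ.* + 1 ℤ.* + suc d
    lhs = trans (ℤP.pos-* (n ℕ.* 1) (suc d)) (cong (ℤ._* + suc d) (ℤP.pos-* n 1))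
    rhs : + (p ℕ.* (1 ℕ.* suc (pred2^ e))) ≡ + p ℤ.* + (1 ℕ.* suc (pred2^ e))
    rhs = ℤP.pos-* p (1 ℕ.* suc (pred2^ e))

  B₁[1+c]≡B₁-num*half^ : ∀ c → B 1 (suc c) ≡ ℕtoℚ (B₁-num c) ℚ.* half^ (2 ℕ.+ 3 ℕ.* c)
  B₁[1+c]≡B₁-num*half^ c = cong₂ (λ m e → ℕtoℚ (suc c ℕ.* suc c ℕ.* (m C c)) ℚ.* half^ e)
    (cong (ℕ._∸ 2) (3[1+c]≡2+[1+3c] c)) (cong (ℕ._∸ 1) (3[1+c]≡1+[2+3c] c))
    where
    3[1+c]≡2+[1+3c] : ∀ c → 3 ℕ.* suc c ≡ 2 ℕ.+ (1 ℕ.+ 3 ℕ.* c)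
    3[1+c]≡2+[1+3c] = solve-∀
    3[1+c]≡1+[2+3c] : ∀ c → 3 ℕ.* suc c ≡ 1 ℕ.+ (2 ℕ.+ 3 ℕ.* c)
    3[1+c]≡1+[2+3c] = solve-∀

open import Data.Nat using (ℕ; suc; _+_; _*_; _≥_)
open import Data.Integer using (+_)
open import Data.Rational using (_≤_; _/_)
open import Relation.Binary.PropositionalEquality using (sym; subst)
open NumeratorBound using (B₁-num; B₁-num-bound)
open DyadicBound using (ℕtoℚ*half^≤; B₁[1+c]≡B₁-num*half^)

mainTheorem3 : (b : ℕ) → b ≥ 1 → B 1 b ≤ (+ 7) / 5
mainTheorem3 (suc c) _ =
  subst (_≤ (+ 7) / 5) (sym (B₁[1+c]≡B₁-num*half^ c)) (ℕtoℚ*half^≤ (B₁-num c) (2 + 3 * c) 7 4 (B₁-num-bound c))
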